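{- Every cactus graph $H=(V,E)$ has a set $S\subseteq V$ such that $H[S]$ is (a) a single vertex, (b) a single edge, or (c) a cycle, and $\pi(S)=S$ for every automorphism $\pi$ of $H$.
   Context: Graphs are finite and simple. A cactus graph is a connected simple graph in which every edge lies on at most one cycle. $H[S]$ is the subgraph induced by $S$. -}

module Defs where

open import Data.Nat using (ℕ; suc)
open import Data.Fin using (Fin; zero; suc; inject₁; fromℕ)
open import Data.Fin.Subset using (Subset; _∈_)
open import Data.Product using (Σ; ∃; _×_; _,_)
open import Data.Sum using (_⊎_)
open import Relation.Nullary using (¬_)
open import Relation.Binary using (Decidable)
open import Relation.Binary.PropositionalEquality using (_≡_)
open import Function.Definitions using (Injective)
open import Function.Bundles using (_⇔_)
open import Data.Fin.Permutation using (Permutation′; _⟨$⟩ʳ_)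

record Graph (n : ℕ) : Set₁ where
  field
    Adj    : Fin n → Fin n → Set
    adj?   : Decidable Adj
    sym    : ∀ {u v} → Adj u v → Adj v u
    irrefl : ∀ {u} → ¬ Adj u u
open Graph public

data Reach {n : ℕ} (G : Graph n) : Fin n → Fin n → Set where
  here : ∀ {u} → Reach G u u
  step : ∀ {u v w} → Adj G u v → Reach G v w → Reach G u w

Connected : {n : ℕ} → Graph n → Set
Connected {n} G = Fin n × (∀ u v → Reach G u v)

SamePair : {n : ℕ} → Fin n → Fin n → Fin n → Fin n → Set
SamePair a b u v = (a ≡ u × b ≡ v) ⊎ (a ≡ v × b ≡ u)

record Cycle {n : ℕ} (G : Graph n) : Set where
  field
    m     : ℕ
    vert  : Fin (suc (suc (suc m))) → Fin n
    inj   : Injective _≡_ _≡_ vert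
    cons  : ∀ (i : Fin (suc (suc m))) → Adj G (vert (inject₁ i)) (vert (suc i))
    close : Adj G (vert (fromℕ (suc (suc m)))) (vert zero)
open Cycle public

CycleEdge : {n : ℕ} {G : Graph n} → Cycle G → Fin n → Fin n → Set
CycleEdge C u v =
  (∃ λ i → SamePair (vert C (inject₁ i)) (vert C (suc i)) u v)
  ⊎ SamePair (vert C (fromℕ (suc (suc (m C))))) (vert C zero) u v

-- Cycles are identified as subgraphs, i.e. by their edge sets.
SameCycle : {n : ℕ} {G : Graph n} → Cycle G → Cycle G → Set
SameCycle C D = ∀ u v → CycleEdge C u v ⇔ CycleEdge D u v

Cactus : {n : ℕ} → Graph n → Set
Cactus G = Connected G ×
  (∀ (C D : Cycle G) u v → Adj G u v → CycleEdge C u v → CycleEdge D u v → SameCycle C D)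

InducedVertex : {n : ℕ} → Graph n → Subset n → Set
InducedVertex {n} G S = ∃ λ (x : Fin n) → ∀ w → w ∈ S ⇔ w ≡ x

InducedEdge : {n : ℕ} → Graph n → Subset n → Set
InducedEdge {n} G S = ∃ λ (x : Fin n) → ∃ λ (y : Fin n) →
  Adj G x y × (∀ w → w ∈ S ⇔ (w ≡ x ⊎ w ≡ y))

InducedCycle : {n : ℕ} → Graph n → Subset n → Set
InducedCycle G S = Σ (Cycle G) λ C →
  (∀ w → w ∈ S ⇔ (∃ λ i → vert C i ≡ w)) ×
  (∀ u v → u ∈ S → v ∈ S → Adj G u v ⇔ CycleEdge C u v)

record Automorphism {n : ℕ} (G : Graph n) : Set where
  field
    perm  : Permutation′ n
    preserves : ∀ u v → Adj G u v ⇔ Adj G (perm ⟨$⟩ʳ u) (perm ⟨$⟩ʳ v)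
open Automorphism public

FixedSet : {n : ℕ} {G : Graph n} → Automorphism G → Subset n → Set
FixedSet π S = ∀ w → w ∈ S ⇔ (∃ λ v → v ∈ S × perm π ⟨$⟩ʳ v ≡ w)

-- Let the center be the set of vertices of minimum eccentricity. If it is a single vertex, take it.
-- Otherwise no vertex c separates two central vertices u and w: every vertex would then be cut off
-- by c from u or from w, so c would have smaller eccentricity. Hence all central vertices lie in
-- one block, and the vertices joined to every central vertex by walks avoiding any single other
-- vertex form exactly that block, which in a cactus is an edge or a chordless cycle (a chord or a
-- second path would put an edge on two cycles). Both sets are defined from adjacency alone, so
-- every automorphism fixes them.

module Submission where

open import Defs renaming (sym to adj-sym; here to reach-here; step to reach-step)
open import Data.Nat as ℕ using (ℕ; zero; suc; _≤_; _<_; z≤n; s≤s)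
import Data.Nat.Properties as ℕ
open import Data.Nat.Induction using (<-rec)
open import Data.Fin using (Fin; zero; suc; inject₁; fromℕ)
open import Data.Fin.Properties using (_≟_; any?; all?; pigeonhole; <⇒≢)
open import Data.Fin.Subset using (Subset) renaming (_∈_ to _∈ˢ_)
open import Data.Fin.Permutation using (_⟨$⟩ʳ_; _⟨$⟩ˡ_; inverseʳ; inverseˡ; flip)
open import Data.Vec using (tabulate)
open import Data.Vec.Properties using (lookup∘tabulate; []=⇒lookup; lookup⇒[]=)
open import Data.Bool using (true)
open import Data.List as List using (List; []; _∷_; _++_; _∷ʳ_; [_]; drop; reverse; length; lookup)
open import Data.List.Properties
  using ( unfold-reverse; ++-identityʳ; ++-assoc; ∷-injectiveˡ; ∷-injectiveʳ; ∷ʳ-injectiveʳ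
        ; length-++-≤ʳ; length-map)
open import Data.List.Relation.Unary.All as All using (All; []; _∷_)
import Data.List.Relation.Unary.All.Properties as All
open import Data.List.Relation.Unary.Any as Any using (here; there)
import Data.List.Relation.Unary.Any.Properties as Any
open import Data.List.Relation.Unary.Unique.Propositional using (Unique; []; _∷_)
open import Data.List.Relation.Unary.Unique.Propositional.Properties using (Unique[x∷xs]⇒x∉xs)
open import Data.List.Membership.Propositional using (_∈_; _∉_)
open import Data.List.Membership.Propositional.Properties using (∈-∃++; ∈-++⁺ˡ; ∈-++⁺ʳ; ∈-++⁻; ∈-lookup; ∈-map⁻)
import Data.List.Membership.DecPropositional as DecMembership
open import Data.List.Relation.Binary.Subset.Propositional using (_⊆_)
open import Data.Product using (Σ; ∃; ∃₂; _×_; _,_; proj₁; proj₂; map₂)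
open import Data.Sum as Sum using (_⊎_; inj₁; inj₂)
open import Data.Empty using (⊥; ⊥-elim)
open import Function using (_∘_; case_of_)
open import Function.Bundles using (mk⇔; Equivalence)
open import Relation.Unary using (U)
open import Relation.Unary.Properties using (U?)
open import Relation.Nullary using (Dec; yes; no; does; ¬_; ¬?; contradiction)
open import Relation.Nullary.Decidable using (_×-dec_; _⊎-dec_; _→-dec_; decidable-stable)
import Relation.Nullary.Decidable as Dec
open import Relation.Binary using (Symmetric; DecidableEquality)
open import Relation.Binary.PropositionalEquality using (_≡_; _≢_; refl; sym; trans; cong; subst; subst₂)

module _ {A : Set} where

  Unique-++⁻ʳ : ∀ xs {ys : List A} → Unique (xs ++ ys) → Unique ys
  Unique-++⁻ʳ []       u       = u
  Unique-++⁻ʳ (_ ∷ xs) (_ ∷ u) = Unique-++⁻ʳ xs u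

  Unique-++⁻ˡ : ∀ xs {ys : List A} → Unique (xs ++ ys) → Unique xs
  Unique-++⁻ˡ []       _        = []
  Unique-++⁻ˡ (_ ∷ xs) (px ∷ u) = All.++⁻ˡ xs px ∷ Unique-++⁻ˡ xs u

  Unique-++-disjoint : ∀ xs {ys : List A} {z} → Unique (xs ++ ys) → z ∈ xs → z ∉ ys
  Unique-++-disjoint (_ ∷ xs) (px ∷ _) (here refl) z∈ys = All.lookup (All.++⁻ʳ xs px) z∈ys refl
  Unique-++-disjoint (_ ∷ xs) (_ ∷ u)  (there z∈xs)     = Unique-++-disjoint xs u z∈xs

  Unique-lookup-injective : ∀ {xs : List A} → Unique xs → ∀ i j → lookup xs i ≡ lookup xs j → i ≡ j
  Unique-lookup-injective (_  ∷ _) zero    zero    _  = refl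
  Unique-lookup-injective (px ∷ _) zero    (suc j) eq = contradiction eq (All.lookup px (∈-lookup j))
  Unique-lookup-injective (px ∷ _) (suc i) zero    eq = contradiction (sym eq) (All.lookup px (∈-lookup i))
  Unique-lookup-injective (_  ∷ u) (suc i) (suc j) eq = cong suc (Unique-lookup-injective u i j eq)

  ∈-++-drop⁻ : ∀ xs ys {z : A} → z ∈ xs ++ drop 1 ys → z ∈ xs ⊎ z ∈ ys
  ∈-++-drop⁻ xs []       z∈ = inj₁ (subst (_ ∈_) (++-identityʳ xs) z∈)
  ∈-++-drop⁻ xs (_ ∷ ys) z∈ = Sum.map₂ there (∈-++⁻ xs z∈)

  ∈-∷ʳ⁻ : ∀ xs {x z : A} → z ∈ xs ∷ʳ x → z ∈ xs ⊎ z ≡ x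
  ∈-∷ʳ⁻ xs z∈ with ∈-++⁻ xs z∈
  ... | inj₁ z∈xs       = inj₁ z∈xs
  ... | inj₂ (here z≡x) = inj₂ z≡x

  Unique-++-middle : ∀ X {M T : List A} {z} → Unique (X ++ M ++ T) → z ∈ M → z ∈ X ⊎ z ∈ T → ⊥
  Unique-++-middle X u z∈M (inj₁ z∈X) = Unique-++-disjoint X u z∈X (∈-++⁺ˡ z∈M)
  Unique-++-middle X {M} u z∈M (inj₂ z∈T) = Unique-++-disjoint M (Unique-++⁻ʳ X u) z∈M z∈T

  consecutive-lookup : ∀ (h : A) t X {p q R} → h ∷ t ≡ X ++ p ∷ q ∷ R →
                       ∃ λ (i : Fin (length t)) → lookup (h ∷ t) (inject₁ i) ≡ p × lookup (h ∷ t) (suc i) ≡ q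
  consecutive-lookup h (_ ∷ _)  []      refl = zero , refl , refl
  consecutive-lookup h (t ∷ ts) (_ ∷ X) eq
    with i , eq₁ , eq₂ ← consecutive-lookup t ts X (∷-injectiveʳ eq) = suc i , eq₁ , eq₂
  consecutive-lookup h [] (_ ∷ [])    ()
  consecutive-lookup h [] (_ ∷ _ ∷ _) ()

  Arc : List A → A → A → Set
  Arc xs a b = ∃₂ λ X Y → ∃ λ T → xs ≡ X ++ (a ∷ Y ++ [ b ]) ++ T

  arc : ∀ {xs a b} → a ∈ xs → b ∈ xs → a ≢ b → Arc xs a b ⊎ Arc xs b a
  arc {a = a} {b} a∈ b∈ a≢b with X , R , refl ← ∈-∃++ a∈ with ∈-++⁻ X b∈
  ... | inj₂ (here b≡a)  = contradiction (sym b≡a) a≢b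
  ... | inj₂ (there b∈R) with Y , T , refl ← ∈-∃++ b∈R =
    inj₁ (X , Y , T , cong (λ L → X ++ a ∷ L) (sym (++-assoc Y [ b ] T)))
  ... | inj₁ b∈X with X′ , Y , refl ← ∈-∃++ b∈X =
    inj₂ (X′ , Y , R , trans (++-assoc X′ (b ∷ Y) (a ∷ R)) (cong (λ L → X′ ++ b ∷ L) (sym (++-assoc Y [ a ] R))))

Unique-length≤ : ∀ {n} {xs : List (Fin n)} → Unique xs → length xs ≤ n
Unique-length≤ {n} {xs} u with length xs ℕ.≤? n
... | yes xs≤n = xs≤n
... | no  xs≰n with pigeonhole (ℕ.≰⇒> xs≰n) (lookup xs)
...   | i , j , i<j , eq = contradiction (Unique-lookup-injective u i j eq) (<⇒≢ i<j)

data Walk {A : Set} (R : A → A → Set) : A → A → List A → Set where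
  ε   : ∀ {u} → Walk R u u [ u ]
  _◅_ : ∀ {u v w xs} → R u v → Walk R v w xs → Walk R u w (u ∷ xs)

infixr 5 _◅_

module _ {A : Set} {R : A → A → Set} where

  Walk-head : ∀ {u v w ws} → Walk R u v (w ∷ ws) → u ≡ w
  Walk-head ε       = refl
  Walk-head (_ ◅ _) = refl

  firstStep : ∀ {u v xs} → u ≢ v → Walk R u v xs →
              ∃₂ λ y ys → xs ≡ u ∷ y ∷ ys × R u y × Walk R y v (y ∷ ys)
  firstStep u≢v ε              = contradiction refl u≢v
  firstStep _   (r ◅ ε)        = _ , [] , refl , r , ε
  firstStep _   (r ◅ (r′ ◅ p)) = _ , _ , refl , r , r′ ◅ p

  source∈ : ∀ {u v xs} → Walk R u v xs → u ∈ xs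
  source∈ ε       = here refl
  source∈ (_ ◅ _) = here refl

  Walk-∷ʳ-target : ∀ {u v xs} → Walk R u v xs → ∃ λ as → xs ≡ as ∷ʳ v
  Walk-∷ʳ-target ε = [] , refl
  Walk-∷ʳ-target (_◅_ {u = u} _ p) with as , refl ← Walk-∷ʳ-target p = u ∷ as , refl

  target∈ : ∀ {u v xs} → Walk R u v xs → v ∈ xs
  target∈ p with as , refl ← Walk-∷ʳ-target p = ∈-++⁺ʳ as (here refl)

  Walk-lookup-step : ∀ {u v t} → Walk R u v (u ∷ t) →
                     ∀ (i : Fin (length t)) → R (lookup (u ∷ t) (inject₁ i)) (lookup (u ∷ t) (suc i))
  Walk-lookup-step (r ◅ ε)       zero    = r
  Walk-lookup-step (r ◅ (_ ◅ _)) zero    = r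
  Walk-lookup-step (_ ◅ p@(_ ◅ _)) (suc i) = Walk-lookup-step p i

  Walk-lookup-last : ∀ {u v t} → Walk R u v (u ∷ t) → lookup (u ∷ t) (fromℕ (length t)) ≡ v
  Walk-lookup-last ε             = refl
  Walk-lookup-last (_ ◅ p@ε)     = Walk-lookup-last p
  Walk-lookup-last (_ ◅ p@(_ ◅ _)) = Walk-lookup-last p

  infixr 5 _⁀_ _⁀⟨_⟩_

  _⁀_ : ∀ {u v w xs ys} → Walk R u v xs → Walk R v w ys → Walk R u w (xs ++ drop 1 ys)
  ε       ⁀ ε       = ε
  ε       ⁀ (r ◅ q) = r ◅ q
  (r ◅ p) ⁀ q       = r ◅ (p ⁀ q)

  _⁀⟨_⟩_ : ∀ {u v w z xs ys} → Walk R u v xs → R v w → Walk R w z ys → Walk R u z (xs ++ ys)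
  ε        ⁀⟨ r ⟩ q = r ◅ q
  (r′ ◅ p) ⁀⟨ r ⟩ q = r′ ◅ (p ⁀⟨ r ⟩ q)

  reverseʷ : Symmetric R → ∀ {u v xs} → Walk R u v xs → Walk R v u (reverse xs)
  reverseʷ s ε = ε
  reverseʷ s (_◅_ {u = u} {xs = xs} r p) =
    subst (Walk R _ u) (sym (unfold-reverse u xs)) (reverseʷ s p ⁀⟨ s r ⟩ ε)

  splitʷ : ∀ xs {c ys u w} → Walk R u w (xs ++ c ∷ ys) → Walk R u c (xs ∷ʳ c) × Walk R c w (c ∷ ys)
  splitʷ []           ε       = ε , ε
  splitʷ []           (r ◅ p) = ε , r ◅ p
  splitʷ (_ ∷ [])     (r ◅ p) with p₁ , p₂ ← splitʷ [] p = r ◅ p₁ , p₂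
  splitʷ (_ ∷ y ∷ xs) (r ◅ p) with p₁ , p₂ ← splitʷ (y ∷ xs) p = r ◅ p₁ , p₂

  mapʷ : ∀ {R′ : A → A → Set} → (∀ {a b} → R a b → R′ a b) → ∀ {u v xs} → Walk R u v xs → Walk R′ u v xs
  mapʷ f ε       = ε
  mapʷ f (r ◅ p) = f r ◅ mapʷ f p

  restrict : ∀ {R′ : A → A → Set} {P : A → Set} → (∀ {a b} → P a → P b → R a b → R′ a b) →
             ∀ {u v xs} → All P xs → Walk R u v xs → Walk R′ u v xs
  restrict f _         ε       = ε
  restrict f (Pu ∷ Ps) (r ◅ p) = f Pu (All.lookup Ps (source∈ p)) r ◅ restrict f Ps p

  restrictSources : ∀ {R′ : A → A → Set} {P : A → Set} → (∀ {a b} → P a → R a b → R′ a b) →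
                    ∀ {u v xs} → All P xs → Walk R u v (xs ∷ʳ v) → Walk R′ u v (xs ∷ʳ v)
  restrictSources f []                 ε       = ε
  restrictSources f (Pu ∷ [])          (r ◅ ε) = f Pu r ◅ ε
  restrictSources f (Pu ∷ Ps@(_ ∷ _))  (r ◅ p) = f Pu r ◅ restrictSources f Ps p

  Walk-arc-split : ∀ X {a Y b T u v} → Walk R u v (X ++ (a ∷ Y ++ [ b ]) ++ T) →
                   Walk R u a (X ∷ʳ a) × Walk R a b (a ∷ Y ++ [ b ]) × Walk R b v (b ∷ T)
  Walk-arc-split X {a} {Y} {b} {T} p
    with p₁ , p₂ ← splitʷ X p
    with p₃ , p₄ ← splitʷ (a ∷ Y) (subst (Walk R a _) (cong (a ∷_) (++-assoc Y [ b ] T)) p₂) =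
    p₁ , p₃ , p₄

  module _ (_≟_ : DecidableEquality A) where
    open DecMembership _≟_ using (_∈?_)

    firstHit : ∀ (L : List A) {v x xs} → Walk R v x xs → x ∈ L →
               ∃₂ λ c qs → c ∈ L × All (_∉ L) qs × Walk R v c (qs ∷ʳ c) × qs ∷ʳ c ⊆ xs
    firstHit L ε x∈ = _ , [] , x∈ , [] , ε , λ z∈ → z∈
    firstHit L (_◅_ {u = v} r p) x∈ with v ∈? L
    ... | yes v∈ = v , [] , v∈ , [] , ε , λ { (here refl) → here refl }
    ... | no  v∉ with c , qs , c∈ , out , w , ⊆xs ← firstHit L p x∈ =
      c , v ∷ qs , c∈ , v∉ ∷ out , r ◅ w , λ { (here e) → here e ; (there m) → there (⊆xs m) }

    toPath : ∀ {u v xs} → Walk R u v xs → ∃ λ ys → Walk R u v ys × Unique ys × ys ⊆ xs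
    toPath ε = _ , ε , [] ∷ [] , λ z → z
    toPath (_◅_ {u = u} r p) with ys , q , uq , ys⊆ ← toPath p | u ∈? ys
    ... | yes u∈ys with as , bs , refl ← ∈-∃++ u∈ys =
      u ∷ bs , proj₂ (splitʷ as q) , Unique-++⁻ʳ as uq , there ∘ ys⊆ ∘ ∈-++⁺ʳ as
    ... | no  u∉ys =
      u ∷ ys , r ◅ q , All.¬Any⇒All¬ ys u∉ys ∷ uq , λ { (here e) → here e ; (there m) → there (ys⊆ m) }

Least : (ℕ → Set) → ℕ → Set
Least P r = P r × (∀ {k} → k < r → ¬ P k)

least-witness : ∀ {P : ℕ → Set} → (∀ k → Dec (P k)) → ∀ {N} → P N → ∃ (Least P)
least-witness {P} P? {N} = <-rec (λ N → P N → ∃ (Least P)) descend N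
  where
  descend : ∀ N → (∀ {M} → M < N → P M → ∃ (Least P)) → P N → ∃ (Least P)
  descend N below PN with ℕ.anyUpTo? P? N
  ... | yes (k , k<N , Pk) = below k<N Pk
  ... | no  none           = N , PN , λ k<N Pk → none (_ , k<N , Pk)

module _ {n : ℕ} {P : Fin n → Set} (P? : ∀ v → Dec (P v)) where

  subsetOf : Subset n
  subsetOf = tabulate (does ∘ P?)

  ∈-subsetOf⁺ : ∀ {v} → P v → v ∈ˢ subsetOf
  ∈-subsetOf⁺ {v} Pv = lookup⇒[]= v subsetOf (trans (lookup∘tabulate (does ∘ P?) v) (holds (P? v)))
    where
    holds : (d : Dec (P v)) → does d ≡ true
    holds (yes _)  = refl
    holds (no ¬Pv) = contradiction Pv ¬Pv

  ∈-subsetOf⁻ : ∀ {v} → v ∈ˢ subsetOf → P v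
  ∈-subsetOf⁻ {v} v∈ with P? v | trans (sym (lookup∘tabulate (does ∘ P?) v)) ([]=⇒lookup v∈)
  ... | yes Pv | _ = Pv
  ... | no  _  | ()

ShortWalk : ∀ {n} → (Fin n → Fin n → Set) → (Fin n → Set) → ℕ → Fin n → Fin n → Set
ShortWalk R P k u v = ∃ λ xs → Walk R u v xs × All P xs × length xs ≤ k

module _ {n : ℕ} {R : Fin n → Fin n → Set} {P : Fin n → Set}
         (R? : ∀ a b → Dec (R a b)) (P? : ∀ a → Dec (P a)) where

  shortWalk? : ∀ k u v → Dec (ShortWalk R P k u v)
  shortWalk? zero    u v = no λ { (_ , ε , _ , ()) ; (_ , _ ◅ _ , _ , ()) }
  shortWalk? (suc k) u v with P? u
  ... | no ¬Pu = no λ (_ , p , Ps , _) → ¬Pu (All.lookup Ps (source∈ p))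
  ... | yes Pu with u ≟ v
  ...   | yes refl = yes (_ , ε , Pu ∷ [] , s≤s z≤n)
  ...   | no  u≢v with any? (λ w → R? u w ×-dec shortWalk? k w v)
  ...     | yes (_ , r , _ , p , Ps , l) = yes (_ , r ◅ p , Pu ∷ Ps , s≤s l)
  ...     | no  ¬step = no λ where
            (_ , ε , _ , _)                → u≢v refl
            (_ , r ◅ p , _ ∷ Ps , s≤s l)   → ¬step (_ , r , _ , p , Ps , l)

  -- A shortest walk is a path, so searching walks with at most n vertices suffices.
  walk? : ∀ u v → Dec (∃ λ xs → Walk R u v xs × All P xs)
  walk? u v = Dec.map′ (λ (xs , p , Ps , _) → xs , p , Ps) shorten (shortWalk? n u v)
    where
    shorten : (∃ λ xs → Walk R u v xs × All P xs) → ShortWalk R P n u v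
    shorten (xs , p , Ps) with ys , q , uq , ys⊆xs ← toPath _≟_ p =
      ys , q , All.anti-mono ys⊆xs Ps , Unique-length≤ uq

module Connectivity {n : ℕ} (H : Graph n) where
  open DecMembership (_≟_ {n}) using (_∈?_)

  walkOf : ∀ {u v} → Reach H u v → ∃ (Walk (Adj H) u v)
  walkOf reach-here       = _ , ε
  walkOf (reach-step a r) = _ , a ◅ proj₂ (walkOf r)

  Avoiding : Fin n → Fin n → Fin n → Set
  Avoiding c u v = ∃ λ xs → Walk (Adj H) u v xs × c ∉ xs

  avoiding? : ∀ c u v → Dec (Avoiding c u v)
  avoiding? c u v = Dec.map′ (map₂ (map₂ All.All¬⇒¬Any)) (λ (xs , p , c∉) → xs , p , All.¬Any⇒All¬ xs c∉)
                             (walk? (adj? H) (λ z → ¬? (c ≟ z)) u v)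

  Avoiding-sym : ∀ {c u v} → Avoiding c u v → Avoiding c v u
  Avoiding-sym (_ , p , c∉) = _ , reverseʷ (adj-sym H) p , c∉ ∘ Any.reverse⁻

  Avoiding-trans : ∀ {c u v w} → Avoiding c u v → Avoiding c v w → Avoiding c u w
  Avoiding-trans (xs , p , c∉xs) (ys , q , c∉ys) = _ , p ⁀ q , Sum.[ c∉xs , c∉ys ] ∘ ∈-++-drop⁻ xs ys

  -- Distance at most k: a walk has one vertex more than it has edges.
  Within : ℕ → Fin n → Fin n → Set
  Within k = ShortWalk (Adj H) U (suc k)

  Within-zero : ∀ {u v} → Within 0 u v → u ≡ v
  Within-zero (_ , ε , _ , _)                 = refl
  Within-zero (_ , _ ◅ ε , _ , s≤s ())
  Within-zero (_ , _ ◅ (_ ◅ _) , _ , s≤s ())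

  Within-cut : ∀ {k s x c} → Within (suc k) s x → s ≢ c → ¬ Avoiding c s x → Within k c x
  Within-cut {c = c} (xs , p , _ , l) s≢c ¬avoid with c ∈? xs
  ... | no  c∉ = contradiction (xs , p , c∉) ¬avoid
  ... | yes c∈ with ∈-∃++ c∈
  ...   | [] , _ , refl = contradiction (Walk-head p) s≢c
  ...   | _ ∷ as , bs , refl =
          c ∷ bs , proj₂ (splitʷ (_ ∷ as) p) , All.universal-U _ ,
          ℕ.≤-trans (length-++-≤ʳ (c ∷ bs) {as}) (ℕ.≤-pred l)

  Ecc≤ : ℕ → Fin n → Set
  Ecc≤ k u = ∀ x → Within k u x

  ecc≤? : ∀ k u → Dec (Ecc≤ k u)
  ecc≤? k u = all? (shortWalk? (adj? H) U? (suc k) u)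

  separator-ecc≤ : ∀ {k u w c} → Ecc≤ (suc k) u → Ecc≤ (suc k) w → u ≢ c → w ≢ c →
                   ¬ Avoiding c u w → Ecc≤ k c
  separator-ecc≤ {u = u} {c = c} eu ew u≢c w≢c ¬uw x with avoiding? c u x
  ... | yes ux = Within-cut (ew x) w≢c (¬uw ∘ Avoiding-trans ux ∘ Avoiding-sym)
  ... | no ¬ux = Within-cut (eu x) u≢c ¬ux

module Radius {n : ℕ} (H : Graph n) (connected : Connected H) where
  open Connectivity H

  private
    ecc-bounded : ∀ u → Ecc≤ n u
    ecc-bounded u x with ys , q , uq , _ ← toPath _≟_ (proj₂ (walkOf (proj₂ connected u x))) =
      ys , q , All.universal-U ys , ℕ.m≤n⇒m≤1+n (Unique-length≤ uq)

    radius-witness : ∃ (Least λ r → ∃ (Ecc≤ r))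
    radius-witness = least-witness (λ k → any? (ecc≤? k)) (proj₁ connected , ecc-bounded _)

  radius : ℕ
  radius = proj₁ radius-witness

  Center : Fin n → Set
  Center = Ecc≤ radius

  center? : ∀ u → Dec (Center u)
  center? = ecc≤? radius

  center : ∃ Center
  center = proj₁ (proj₂ radius-witness)

  center-avoiding : ∀ {u w c} → Center u → Center w → u ≢ w → c ≢ u → c ≢ w → Avoiding c u w
  center-avoiding {u} {w} {c} cu cw u≢w c≢u c≢w =
    decidable-stable (avoiding? c u w) λ ¬uw → impossible radius cu cw (proj₂ (proj₂ radius-witness)) ¬uw
    where
    impossible : ∀ k → Ecc≤ k u → Ecc≤ k w → (∀ {j} → j < k → ¬ ∃ (Ecc≤ j)) → ¬ Avoiding c u w → ⊥
    impossible zero    eu _  _       _   = u≢w (Within-zero (eu w))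
    impossible (suc k) eu ew minimal ¬uw =
      minimal (ℕ.n<1+n k) (c , separator-ecc≤ eu ew (c≢u ∘ sym) (c≢w ∘ sym) ¬uw)

module Symmetry {n : ℕ} (H : Graph n) where
  open Connectivity H

  ⟦_⟧ : Automorphism H → Fin n → Fin n
  ⟦ π ⟧ v = perm π ⟨$⟩ʳ v

  _⁻¹ : Automorphism H → Automorphism H
  π ⁻¹ = record { perm = flip (perm π) ; preserves = λ _ _ → mk⇔ reflect preserve }
    where
    cancel : ∀ {v} → perm π ⟨$⟩ʳ (perm π ⟨$⟩ˡ v) ≡ v
    cancel = inverseʳ (perm π)
    reflect : ∀ {u v} → Adj H u v → Adj H (perm π ⟨$⟩ˡ u) (perm π ⟨$⟩ˡ v)
    reflect = Equivalence.from (preserves π _ _) ∘ subst₂ (Adj H) (sym cancel) (sym cancel)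
    preserve : ∀ {u v} → Adj H (perm π ⟨$⟩ˡ u) (perm π ⟨$⟩ˡ v) → Adj H u v
    preserve = subst₂ (Adj H) cancel cancel ∘ Equivalence.to (preserves π _ _)

  ⟦⟧-inverseʳ : ∀ π v → ⟦ π ⟧ (⟦ π ⁻¹ ⟧ v) ≡ v
  ⟦⟧-inverseʳ π v = inverseʳ (perm π)

  ⟦⟧-injective : ∀ π {u v} → ⟦ π ⟧ u ≡ ⟦ π ⟧ v → u ≡ v
  ⟦⟧-injective π {u} {v} eq = trans (sym (inverseˡ (perm π))) (trans (cong (perm π ⟨$⟩ˡ_) eq) (inverseˡ (perm π)))

  walk-image : ∀ π {u v xs} → Walk (Adj H) u v xs → Walk (Adj H) (⟦ π ⟧ u) (⟦ π ⟧ v) (List.map ⟦ π ⟧ xs)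
  walk-image π ε       = ε
  walk-image π (r ◅ p) = Equivalence.to (preserves π _ _) r ◅ walk-image π p

  Ecc≤-image : ∀ π {k u} → Ecc≤ k u → Ecc≤ k (⟦ π ⟧ u)
  Ecc≤-image π {u = u} eu x with xs , p , _ , l ← eu (⟦ π ⁻¹ ⟧ x) =
    List.map ⟦ π ⟧ xs ,
    subst (λ y → Walk (Adj H) (⟦ π ⟧ u) y (List.map ⟦ π ⟧ xs)) (⟦⟧-inverseʳ π x) (walk-image π p) ,
    All.universal-U _ , subst (_≤ _) (sym (length-map ⟦ π ⟧ xs)) l

  Avoiding-image : ∀ π {c u v} → Avoiding c u v → Avoiding (⟦ π ⟧ c) (⟦ π ⟧ u) (⟦ π ⟧ v)
  Avoiding-image π (xs , p , c∉) = _ , walk-image π p , λ πc∈ →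
    let (z , z∈ , πc≡πz) = ∈-map⁻ ⟦ π ⟧ πc∈ in c∉ (subst (_∈ xs) (sym (⟦⟧-injective π πc≡πz)) z∈)

  Invariant : (Fin n → Set) → Set
  Invariant P = ∀ π {v} → P v → P (⟦ π ⟧ v)

  fixedSet : {P : Fin n → Set} (P? : ∀ v → Dec (P v)) → Invariant P → ∀ π → FixedSet π (subsetOf P?)
  fixedSet P? invariant π w = mk⇔
    (λ w∈ → ⟦ π ⁻¹ ⟧ w , ∈-subsetOf⁺ P? (invariant (π ⁻¹) (∈-subsetOf⁻ P? w∈)) , ⟦⟧-inverseʳ π w)
    (λ { (v , v∈ , refl) → ∈-subsetOf⁺ P? (invariant π (∈-subsetOf⁻ P? v∈)) })

module Cycles {n : ℕ} (H : Graph n) where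

  record CycleWalk : Set where
    field
      x₀ x₁ x₂ last : Fin n
      rest          : List (Fin n)
      walk          : Walk (Adj H) x₀ last (x₀ ∷ x₁ ∷ x₂ ∷ rest)
      closing       : Adj H last x₀
      unique        : Unique (x₀ ∷ x₁ ∷ x₂ ∷ rest)

    vertices : List (Fin n)
    vertices = x₀ ∷ x₁ ∷ x₂ ∷ rest

  open CycleWalk public

  toCycle : CycleWalk → Cycle H
  toCycle C = record
    { m     = length (rest C)
    ; vert  = lookup (vertices C)
    ; inj   = λ {i} {j} → Unique-lookup-injective (unique C) i j
    ; cons  = Walk-lookup-step (walk C)
    ; close = subst (λ z → Adj H z (x₀ C)) (sym (Walk-lookup-last (walk C))) (closing C)
    }

  Edge : CycleWalk → Fin n → Fin n → Set
  Edge C = CycleEdge (toCycle C)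

  CycleEdge-sym : ∀ (D : Cycle H) {u v} → CycleEdge D u v → CycleEdge D v u
  CycleEdge-sym D = Sum.map (map₂ Sum.swap) Sum.swap

  CycleEdge-resp-SamePair : ∀ (D : Cycle H) {a b u v} → CycleEdge D u v → SamePair a b u v → CycleEdge D a b
  CycleEdge-resp-SamePair D e (inj₁ (refl , refl)) = e
  CycleEdge-resp-SamePair D e (inj₂ (refl , refl)) = CycleEdge-sym D e

  SamePair-adj : ∀ {a b u v} → Adj H a b → SamePair a b u v → Adj H u v
  SamePair-adj ab (inj₁ (refl , refl)) = ab
  SamePair-adj ab (inj₂ (refl , refl)) = adj-sym H ab

  CycleEdge⇒Adj : ∀ (D : Cycle H) {u v} → CycleEdge D u v → Adj H u v
  CycleEdge⇒Adj D (inj₁ (i , e)) = SamePair-adj (cons D i) e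
  CycleEdge⇒Adj D (inj₂ e)       = SamePair-adj (close D) e

  samePair? : ∀ a b u v → Dec (SamePair {n} a b u v)
  samePair? a b u v = ((a ≟ u) ×-dec (b ≟ v)) ⊎-dec ((a ≟ v) ×-dec (b ≟ u))

  cycleEdge? : ∀ (D : Cycle H) u v → Dec (CycleEdge D u v)
  cycleEdge? D u v = any? (λ i → samePair? _ _ u v) ⊎-dec samePair? _ _ u v

  consecutive-edge : ∀ C X {p q R} → vertices C ≡ X ++ p ∷ q ∷ R → Edge C p q
  consecutive-edge C X eq with i , eq₁ , eq₂ ← consecutive-lookup (x₀ C) _ X eq = inj₁ (i , inj₁ (eq₁ , eq₂))

  closing-edge : ∀ C → Edge C (last C) (x₀ C)
  closing-edge C = inj₂ (inj₁ (Walk-lookup-last (walk C) , refl))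

  last-≡ : ∀ C X {t} → vertices C ≡ X ∷ʳ t → last C ≡ t
  last-≡ C X eq with as , eq′ ← Walk-∷ʳ-target (walk C) = ∷ʳ-injectiveʳ as X (trans (sym eq′) eq)

  edge-at : ∀ C {t} → t ∈ vertices C → ∃ (Edge C t)
  edge-at C t∈ with ∈-∃++ t∈
  ... | X , y ∷ R , eq = y , consecutive-edge C X eq
  ... | X , []    , eq = x₀ C , subst (λ z → Edge C z (x₀ C)) (last-≡ C X eq) (closing-edge C)

  SamePair-∈ : ∀ {L : List (Fin n)} {a b u v} → a ∈ L → b ∈ L → SamePair a b u v → u ∈ L × v ∈ L
  SamePair-∈ a∈ b∈ (inj₁ (refl , refl)) = a∈ , b∈
  SamePair-∈ a∈ b∈ (inj₂ (refl , refl)) = b∈ , a∈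

  Edge-∈ : ∀ C {u v} → Edge C u v → u ∈ vertices C × v ∈ vertices C
  Edge-∈ C (inj₁ (i , e)) = SamePair-∈ (∈-lookup (inject₁ i)) (∈-lookup (suc i)) e
  Edge-∈ C (inj₂ e)       = SamePair-∈ (∈-lookup (fromℕ _)) (∈-lookup zero) e

  AdjExcept : Fin n → Fin n → Fin n → Fin n → Set
  AdjExcept x y a b = Adj H a b × ¬ SamePair a b x y

  avoiding⇒AdjExcept : ∀ {c x y u v xs} → c ≡ x ⊎ c ≡ y → c ∉ xs →
                       Walk (Adj H) u v xs → Walk (AdjExcept x y) u v xs
  avoiding⇒AdjExcept {xs = xs} c∈xy c∉ = restrict (λ c≢a c≢b ab → ab , avoids c∈xy c≢a c≢b) (All.¬Any⇒All¬ xs c∉)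
    where
    avoids : ∀ {c x y a b} → c ≡ x ⊎ c ≡ y → c ≢ a → c ≢ b → ¬ SamePair a b x y
    avoids (inj₁ refl) c≢a _   (inj₁ (refl , _)) = c≢a refl
    avoids (inj₁ refl) _   c≢b (inj₂ (_ , refl)) = c≢b refl
    avoids (inj₂ refl) _   c≢b (inj₁ (_ , refl)) = c≢b refl
    avoids (inj₂ refl) c≢a _   (inj₂ (refl , _)) = c≢a refl

  cycleFrom : ∀ {x y xs} → Adj H x y → Walk (AdjExcept x y) y x xs →
              Σ CycleWalk λ D → x₀ D ≡ y × last D ≡ x × vertices D ⊆ xs
  cycleFrom xy p with toPath _≟_ p
  ... | _ , ε , _ , _ = contradiction xy (irrefl H)
  ... | _ , (_ , ¬yx) ◅ ε , _ , _ = contradiction (inj₂ (refl , refl)) ¬yx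
  ... | _ , q@(_ ◅ _ ◅ ε) , uq , ⊆xs =
        record { walk = mapʷ proj₁ q ; closing = xy ; unique = uq } , refl , refl , ⊆xs
  ... | _ , q@(_ ◅ _ ◅ _ ◅ _) , uq , ⊆xs =
        record { walk = mapʷ proj₁ q ; closing = xy ; unique = uq } , refl , refl , ⊆xs

module CactusCenter {n : ℕ} (H : Graph n) (cactus : Cactus H) where
  open Connectivity H
  open Radius H (proj₁ cactus) public
  open Cycles H
  open DecMembership (_≟_ {n}) using (_∈?_)

  sharing-edge⇒⊆ : ∀ C D {x y} → Edge C x y → Edge D x y → vertices C ⊆ vertices D
  sharing-edge⇒⊆ C D xy xy′ t∈ with t′ , tt′ ← edge-at C t∈ =
    proj₁ (Edge-∈ D (Equivalence.to (same _ t′) tt′))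
    where
    same : SameCycle (toCycle C) (toCycle D)
    same = proj₂ cactus (toCycle C) (toCycle D) _ _ (CycleEdge⇒Adj (toCycle C) xy) xy xy′

  closing-walk⊇cycle : ∀ C {x y xs} → Edge C x y → Walk (AdjExcept x y) y x xs → vertices C ⊆ xs
  closing-walk⊇cycle C xy p with D , refl , refl , D⊆xs ← cycleFrom (CycleEdge⇒Adj (toCycle C) xy) p =
    D⊆xs ∘ sharing-edge⇒⊆ C D xy (closing-edge D)

  OffCycle : CycleWalk → Fin n → Fin n → Set
  OffCycle C a b = Adj H a b × ¬ Edge C a b

  OffCycle-sym : ∀ C {a b} → OffCycle C a b → OffCycle C b a
  OffCycle-sym C (ab , ¬e) = adj-sym H ab , ¬e ∘ CycleEdge-sym (toCycle C)

  OffCycle⇒AdjExcept : ∀ C {x y a b} → Edge C x y → OffCycle C a b → AdjExcept x y a b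
  OffCycle⇒AdjExcept C xy (ab , ¬e) = ab , ¬e ∘ CycleEdge-resp-SamePair (toCycle C) xy

  Ear : CycleWalk → Fin n → Fin n → List (Fin n) → Set
  Ear C c a ws = Walk (OffCycle C) c a ws × (∀ {z} → z ∈ ws → z ∈ vertices C → z ≡ c ⊎ z ≡ a)

  Ear-reverse : ∀ C {c a ws} → Ear C c a ws → Ear C a c (reverse ws)
  Ear-reverse C (p , meets) = reverseʷ (OffCycle-sym C) p , λ z∈ z∈C → Sum.swap (meets (Any.reverse⁻ z∈) z∈C)

  -- The arc from c to a followed by the ear back is a walk closing the edge from c into the arc,
  -- yet it misses the vertex t of C outside the arc.
  no-ear-outer : ∀ C X Y T {c a ws t} → vertices C ≡ X ++ (c ∷ Y ++ [ a ]) ++ T → c ≢ a →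
                 Ear C c a ws → t ∈ X ⊎ t ∈ T → ⊥
  no-ear-outer C X Y T {c} {a} {ws} {t} eq c≢a (ear , meets) t∈XT
    with _ , arcWalk , _ ← Walk-arc-split X (subst (Walk (Adj H) _ _) eq (walk C))
    with y , ys , arc≡ , _ , seg ← firstStep c≢a arcWalk =
    Sum.[ t∉seg arc≡ , t∉ws ]
      (∈-++-drop⁻ (y ∷ ys) (reverse ws) (closing-walk⊇cycle C (cy arc≡) (back arc≡ seg) t∈C))
    where
    uq : Unique (X ++ (c ∷ Y ++ [ a ]) ++ T)
    uq = subst Unique eq (unique C)
    t∉arc : t ∉ c ∷ Y ++ [ a ]
    t∉arc t∈ = Unique-++-middle X uq t∈ t∈XT
    t∈C : t ∈ vertices C
    t∈C = subst (t ∈_) (sym eq) (Sum.[ ∈-++⁺ˡ , ∈-++⁺ʳ X ∘ ∈-++⁺ʳ (c ∷ Y ++ [ a ]) ] t∈XT)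
    cy : ∀ {y ys} → c ∷ Y ++ [ a ] ≡ c ∷ y ∷ ys → Edge C c y
    cy arc≡ = consecutive-edge C X (trans eq (cong (λ L → X ++ L ++ T) arc≡))
    back : ∀ {y ys} → (arc≡ : c ∷ Y ++ [ a ] ≡ c ∷ y ∷ ys) → Walk (Adj H) y a (y ∷ ys) →
           Walk (AdjExcept c y) y c ((y ∷ ys) ++ drop 1 (reverse ws))
    back arc≡ seg =
      avoiding⇒AdjExcept (inj₁ refl) (Unique[x∷xs]⇒x∉xs (subst Unique arc≡ (Unique-++⁻ˡ _ (Unique-++⁻ʳ X uq)))) seg
      ⁀ mapʷ (OffCycle⇒AdjExcept C (cy arc≡)) (reverseʷ (OffCycle-sym C) ear)
    t∉seg : ∀ {y ys} → c ∷ Y ++ [ a ] ≡ c ∷ y ∷ ys → t ∉ y ∷ ys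
    t∉seg arc≡ = t∉arc ∘ subst (t ∈_) (sym arc≡) ∘ there
    t∉ws : t ∉ reverse ws
    t∉ws t∈ = Sum.[ (λ { refl → t∉arc (here refl) }) , (λ { refl → t∉arc (there (∈-++⁺ʳ Y (here refl))) }) ]
                  (meets (Any.reverse⁻ t∈) t∈C)

  -- Here the ear closes up the edge a c of C, yet misses the inner vertex t.
  no-ear-inner : ∀ C {c Y a ws} → vertices C ≡ c ∷ Y ++ [ a ] → Ear C c a ws → ⊥
  no-ear-inner C {Y = []} ()
  no-ear-inner C {c} {t ∷ Y} {a} {ws} eq (ear , meets)
    with c∉ ∷ t∉ ∷ _ ← subst Unique eq (unique C) =
    Sum.[ All.lookup c∉ (here refl) ∘ sym , All.lookup t∉ (∈-++⁺ʳ Y (here refl)) ]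
      (meets (closing-walk⊇cycle C ac (mapʷ (OffCycle⇒AdjExcept C ac) ear) t∈C) t∈C)
    where
    t∈C : t ∈ vertices C
    t∈C = subst (t ∈_) (sym eq) (there (here refl))
    ac : Edge C a c
    ac = subst₂ (Edge C) (last-≡ C (c ∷ t ∷ Y) eq) (∷-injectiveˡ eq) (closing-edge C)

  no-ear-ordered : ∀ C X Y T {c a ws} → vertices C ≡ X ++ (c ∷ Y ++ [ a ]) ++ T → c ≢ a → Ear C c a ws → ⊥
  no-ear-ordered C (x ∷ X) Y T       eq c≢a e = no-ear-outer C (x ∷ X) Y T eq c≢a e (inj₁ (here refl))
  no-ear-ordered C []      Y (t ∷ T) eq c≢a e = no-ear-outer C [] Y (t ∷ T) eq c≢a e (inj₂ (here refl))
  no-ear-ordered C []      Y []      eq _   e = no-ear-inner C {Y = Y} (trans eq (++-identityʳ _)) e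

  no-ear : ∀ C {c a ws} → c ∈ vertices C → a ∈ vertices C → c ≢ a → Ear C c a ws → ⊥
  no-ear C c∈ a∈ c≢a e with arc c∈ a∈ c≢a
  ... | inj₁ (X , Y , T , eq) = no-ear-ordered C X Y T eq c≢a e
  ... | inj₂ (X , Y , T , eq) = no-ear-ordered C X Y T eq (c≢a ∘ sym) (Ear-reverse C e)

  chordless : ∀ C {a b} → a ∈ vertices C → b ∈ vertices C → Adj H a b → Edge C a b
  chordless C a∈ b∈ ab with cycleEdge? (toCycle C) _ _
  ... | yes e  = e
  ... | no  ¬e = ⊥-elim (no-ear C a∈ b∈ (λ { refl → irrefl H ab }) ((ab , ¬e) ◅ ε , ends))
    where
    ends : ∀ {z a b} → z ∈ a ∷ b ∷ [] → z ∈ vertices C → z ≡ a ⊎ z ≡ b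
    ends (here z≡a)         _ = inj₁ z≡a
    ends (there (here z≡b)) _ = inj₂ z≡b

  arc-avoiding : ∀ C X Y T {a b c} → vertices C ≡ X ++ (a ∷ Y ++ [ b ]) ++ T → c ≢ a → c ≢ b → Avoiding c a b
  arc-avoiding C X Y T {a} {b} {c} eq c≢a c≢b
    with w₁ , arcWalk , w₃ ← Walk-arc-split X (subst (Walk (Adj H) _ _) eq (walk C)) | c ∈? Y
  ... | no c∉Y = _ , arcWalk , λ where
          (here c≡a)  → c≢a c≡a
          (there c∈)  → Sum.[ c∉Y , (λ { (here c≡b) → c≢b c≡b }) ] (∈-++⁻ Y c∈)
  ... | yes c∈Y = Avoiding-sym (_ , w₃ ⁀⟨ closing C ⟩ w₁ , c∉around)
    where
    c∉outside : c ∈ X ⊎ c ∈ T → ⊥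
    c∉outside = Unique-++-middle X (subst Unique eq (unique C)) (there (∈-++⁺ˡ c∈Y))
    c∉around : c ∉ (b ∷ T) ++ X ∷ʳ a
    c∉around (here c≡b)  = c≢b c≡b
    c∉around (there c∈) with ∈-++⁻ T c∈
    ... | inj₁ c∈T = c∉outside (inj₂ c∈T)
    ... | inj₂ c∈X∷ʳa = Sum.[ c∉outside ∘ inj₁ , c≢a ] (∈-∷ʳ⁻ X c∈X∷ʳa)

  cycle-avoiding : ∀ C {a b c} → a ∈ vertices C → b ∈ vertices C → c ≢ a → c ≢ b → Avoiding c a b
  cycle-avoiding C {a} {b} a∈ b∈ c≢a c≢b with a ≟ b
  ... | yes refl = _ , ε , λ { (here c≡a) → c≢a c≡a }
  ... | no  a≢b with arc a∈ b∈ a≢b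
  ...   | inj₁ (X , Y , T , eq) = arc-avoiding C X Y T eq c≢a c≢b
  ...   | inj₂ (X , Y , T , eq) = Avoiding-sym (arc-avoiding C X Y T eq c≢b c≢a)

  -- Walk from v to its first vertex c on C, then from v to a vertex a′ ≠ c of C avoiding c: together an ear.
  off-cycle-absurd : ∀ C {v} → v ∉ vertices C →
                     (∀ {c} → c ∈ vertices C → ∃ λ a → a ∈ vertices C × Avoiding c v a) → ⊥
  off-cycle-absurd C {v} v∉ avoid
    with _ , p ← walkOf (proj₂ (proj₁ cactus) v (x₀ C))
    with c , qs , c∈ , qs∉ , toC , _ ← firstHit _≟_ (vertices C) p (here refl)
    with a , a∈ , ys , q , c∉ys ← avoid c∈
    with a′ , qs′ , a′∈ , qs′∉ , toA′ , ⊆ys ← firstHit _≟_ (vertices C) q a∈ =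
    no-ear C c∈ a′∈ (λ { refl → c∉ys (⊆ys (∈-++⁺ʳ qs′ (here refl))) })
      ( reverseʷ (OffCycle-sym C) (restrictSources leaves qs∉ toC) ⁀ restrictSources leaves qs′∉ toA′
      , λ z∈ z∈C → Sum.map (ends qs∉ z∈C ∘ Any.reverse⁻) (ends qs′∉ z∈C) (∈-++-drop⁻ (reverse (qs ∷ʳ c)) _ z∈))
    where
    leaves : ∀ {a b} → a ∉ vertices C → Adj H a b → OffCycle C a b
    leaves a∉ ab = ab , a∉ ∘ proj₁ ∘ Edge-∈ C
    ends : ∀ {qs z e} → All (_∉ vertices C) qs → z ∈ vertices C → z ∈ qs ∷ʳ e → z ≡ e
    ends {qs} qs∉ z∈C z∈ = Sum.[ (λ z∈qs → contradiction z∈C (All.lookup qs∉ z∈qs)) , (λ z≡e → z≡e) ] (∈-∷ʳ⁻ qs z∈)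

  InCentralBlock : Fin n → Set
  InCentralBlock v = ∀ z → Center z → ∀ c → c ≢ v → c ≢ z → Avoiding c v z

  inCentralBlock? : ∀ v → Dec (InCentralBlock v)
  inCentralBlock? v = all? λ z → center? z →-dec all? λ c → ¬? (c ≟ v) →-dec ¬? (c ≟ z) →-dec avoiding? c v z

  centralBlock : Subset n
  centralBlock = subsetOf inCentralBlock?

  Center⇒InCentralBlock : ∀ {u} → Center u → InCentralBlock u
  Center⇒InCentralBlock {u} cu z cz c c≢u c≢z with u ≟ z
  ... | yes refl = _ , ε , λ { (here c≡u) → c≢u c≡u }
  ... | no  u≢z  = center-avoiding cu cz u≢z c≢u c≢z

  module OnCycle (C : CycleWalk) {u w} (u∈ : u ∈ vertices C) (w∈ : w ∈ vertices C)
                 (cu : Center u) (cw : Center w) (u≢w : u ≢ w) where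

    another-center : ∀ c → ∃ λ a → a ∈ vertices C × Center a × a ≢ c
    another-center c with c ≟ u
    ... | yes refl = w , w∈ , cw , u≢w ∘ sym
    ... | no  c≢u  = u , u∈ , cu , c≢u ∘ sym

    joined⇒∈cycle : ∀ {v} → (∀ {a c} → Center a → v ≢ a → c ≢ v → c ≢ a → Avoiding c v a) → v ∈ vertices C
    joined⇒∈cycle {v} joined with v ∈? vertices C
    ... | yes v∈ = v∈
    ... | no  v∉ = ⊥-elim (off-cycle-absurd C v∉ λ {c} c∈ →
          let a , a∈ , ca , a≢c = another-center c
          in a , a∈ , joined ca (λ { refl → v∉ a∈ }) (λ { refl → v∉ c∈ }) (a≢c ∘ sym))

    Center⇒∈cycle : ∀ {z} → Center z → z ∈ vertices C
    Center⇒∈cycle cz = joined⇒∈cycle (center-avoiding cz)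

    InCentralBlock⇒∈cycle : ∀ {v} → InCentralBlock v → v ∈ vertices C
    InCentralBlock⇒∈cycle iv = joined⇒∈cycle λ ca _ → iv _ ca _

    ∈cycle⇒InCentralBlock : ∀ {v} → v ∈ vertices C → InCentralBlock v
    ∈cycle⇒InCentralBlock v∈ z cz c c≢v c≢z = cycle-avoiding C v∈ (Center⇒∈cycle cz) c≢v c≢z

    centralBlock-cycle : InducedCycle H centralBlock
    centralBlock-cycle = toCycle C , (λ v → mk⇔ to from) ,
                         λ a b a∈ b∈ → mk⇔ (chordless C (∈C a∈) (∈C b∈)) (CycleEdge⇒Adj (toCycle C))
      where
      ∈C : ∀ {v} → v ∈ˢ centralBlock → v ∈ vertices C
      ∈C = InCentralBlock⇒∈cycle ∘ ∈-subsetOf⁻ inCentralBlock?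
      to : ∀ {v} → v ∈ˢ centralBlock → ∃ λ i → lookup (vertices C) i ≡ v
      to v∈ = Any.index (∈C v∈) , sym (Any.lookup-index (∈C v∈))
      from : ∀ {v} → (∃ λ i → lookup (vertices C) i ≡ v) → v ∈ˢ centralBlock
      from (i , refl) = ∈-subsetOf⁺ inCentralBlock? (∈cycle⇒InCentralBlock (∈-lookup i))

  -- If no other walk joins u and w, a vertex of the block reaching u avoiding w and w avoiding u would give one.
  bridge-centralBlock : ∀ {u w} → Center u → Center w → Adj H u w →
                        (∀ {xs} → ¬ Walk (AdjExcept u w) w u xs) → InducedEdge H centralBlock
  bridge-centralBlock {u} {w} cu cw uw no-detour = u , w , uw , λ v → mk⇔ (members v) others
    where
    others : ∀ {v} → v ≡ u ⊎ v ≡ w → v ∈ˢ centralBlock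
    others (inj₁ refl) = ∈-subsetOf⁺ inCentralBlock? (Center⇒InCentralBlock cu)
    others (inj₂ refl) = ∈-subsetOf⁺ inCentralBlock? (Center⇒InCentralBlock cw)
    members : ∀ v → v ∈ˢ centralBlock → v ≡ u ⊎ v ≡ w
    members v v∈ with v ≟ u | v ≟ w
    ... | yes v≡u | _       = inj₁ v≡u
    ... | no  _   | yes v≡w = inj₂ v≡w
    ... | no  v≢u | no  v≢w
      with _ , p , w∉p ← ∈-subsetOf⁻ inCentralBlock? v∈ u cu w (v≢w ∘ sym) (λ { refl → irrefl H uw })
      with _ , q , u∉q ← ∈-subsetOf⁻ inCentralBlock? v∈ w cw u (v≢u ∘ sym) (λ { refl → irrefl H uw }) =
      ⊥-elim (no-detour ( avoiding⇒AdjExcept (inj₁ refl) (u∉q ∘ Any.reverse⁻) (reverseʷ (adj-sym H) q)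
                        ⁀ avoiding⇒AdjExcept (inj₂ refl) w∉p p))

  adjacent-centers : ∀ {u w} → Center u → Center w → u ≢ w → Adj H u w →
                     InducedEdge H centralBlock ⊎ InducedCycle H centralBlock
  adjacent-centers {u} {w} cu cw u≢w uw with walk? (λ a b → adj? H a b ×-dec ¬? (samePair? a b u w)) U? w u
  ... | no  ¬detour = inj₁ (bridge-centralBlock cu cw uw λ p → ¬detour (_ , p , All.universal-U _))
  ... | yes (_ , p , _) with D , refl , refl , _ ← cycleFrom uw p =
    inj₂ (OnCycle.centralBlock-cycle D (target∈ (walk D)) (here refl) cu cw u≢w)

  -- w reaches p avoiding u and reaches u avoiding anything else, so w cannot lie off C.
  center∈cycle : ∀ C {u w p} → Center u → Center w → u ≢ w → u ∈ vertices C → p ∈ vertices C →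
                 Avoiding u w p → w ∈ vertices C
  center∈cycle C {u} {w} {p} cu cw u≢w u∈ p∈ wp with w ∈? vertices C
  ... | yes w∈ = w∈
  ... | no  w∉ = ⊥-elim (off-cycle-absurd C w∉ λ {c} c∈ → case c ≟ u of λ where
          (yes refl) → p , p∈ , wp
          (no  c≢u)  → u , u∈ , center-avoiding cw cu (u≢w ∘ sym) (λ { refl → w∉ c∈ }) c≢u)

  -- The first edge u p₁ of a u–w path closes up, through a p₁-avoiding u–w walk, into a cycle through u and w.
  nonadjacent-centers : ∀ {u w} → Center u → Center w → u ≢ w → ¬ Adj H u w → InducedCycle H centralBlock
  nonadjacent-centers {u} {w} cu cw u≢w ¬uw
    with _ , path , uq , _ ← toPath _≟_ (proj₂ (walkOf (proj₂ (proj₁ cactus) u w)))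
    with p₁ , _ , refl , up₁ , rest ← firstStep u≢w path
    with u∉rest ← Unique[x∷xs]⇒x∉xs uq
    with _ , q , p₁∉q ← center-avoiding cu cw u≢w (λ { refl → u∉rest (here refl) }) (λ { refl → ¬uw up₁ })
    with D , refl , refl , _ ←
           cycleFrom up₁ ( avoiding⇒AdjExcept (inj₁ refl) u∉rest rest
                         ⁀ avoiding⇒AdjExcept (inj₂ refl) (p₁∉q ∘ Any.reverse⁻) (reverseʷ (adj-sym H) q)) =
    OnCycle.centralBlock-cycle D u∈D
      (center∈cycle D cu cw u≢w u∈D (here refl) (Avoiding-sym (_ , rest , u∉rest))) cu cw u≢w
    where
    u∈D : last D ∈ vertices D
    u∈D = target∈ (walk D)

  centralBlock-shape : ∀ {u w} → Center u → Center w → u ≢ w →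
                       InducedEdge H centralBlock ⊎ InducedCycle H centralBlock
  centralBlock-shape {u} {w} cu cw u≢w with adj? H u w
  ... | yes uw = adjacent-centers cu cw u≢w uw
  ... | no ¬uw = inj₂ (nonadjacent-centers cu cw u≢w ¬uw)

  two-centers? : Dec (∃₂ λ u w → Center u × Center w × u ≢ w)
  two-centers? = any? λ u → any? λ w → center? u ×-dec center? w ×-dec ¬? (u ≟ w)

  single-center : ¬ (∃₂ λ u w → Center u × Center w × u ≢ w) → InducedVertex H (subsetOf center?)
  single-center ¬two = proj₁ center , λ v → mk⇔
    (λ v∈ → decidable-stable (v ≟ _) λ v≢ → ¬two (_ , _ , ∈-subsetOf⁻ center? v∈ , proj₂ center , v≢))
    (λ { refl → ∈-subsetOf⁺ center? (proj₂ center) })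

  open Symmetry H

  Center-invariant : Invariant Center
  Center-invariant π = Ecc≤-image π

  InCentralBlock-invariant : Invariant InCentralBlock
  InCentralBlock-invariant π {v} iv z cz c c≢πv c≢z =
    subst₂ (λ c′ z′ → Avoiding c′ (⟦ π ⟧ v) z′) (⟦⟧-inverseʳ π c) (⟦⟧-inverseʳ π z)
      (Avoiding-image π (iv _ (Ecc≤-image (π ⁻¹) cz) _
        (λ { refl → c≢πv (sym (⟦⟧-inverseʳ π c)) })
        (c≢z ∘ ⟦⟧-injective (π ⁻¹))))

lemma8p1 : ∀ {n : ℕ} (H : Graph n) → Cactus H →
    ∃ λ (S : Subset n) →
      (InducedVertex H S ⊎ InducedEdge H S ⊎ InducedCycle H S) ×
      (∀ (π : Automorphism H) → FixedSet π S)
lemma8p1 H cactus with CactusCenter.two-centers? H cactus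
... | yes (_ , _ , cu , cw , u≢w) =
  centralBlock , inj₂ (centralBlock-shape cu cw u≢w) , fixedSet inCentralBlock? InCentralBlock-invariant
  where open CactusCenter H cactus; open Symmetry H
... | no ¬two =
  subsetOf center? , inj₁ (single-center ¬two) , fixedSet center? Center-invariant
  where open CactusCenter H cactus; open Symmetry H
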